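{- There exists $N\in\mathbb{N}$ such that for all integers $r\ge N$, the set $\{1,2,\dots,r\}$ can be partitioned into exactly three MSTD subsets.
   Context: For a set $A$ of integers, $A+A=\{x+y:x,y\in A\}$ and $A-A=\{x-y:x,y\in A\}$. A finite set $A$ is MSTD if $|A+A|>|A-A|$. A partition into three subsets means three nonempty pairwise disjoint sets whose union is the given set. -}

module Defs where

open import Data.Nat using (ℕ; suc; _+_; _*_; _>_)
import Data.Nat.Properties as ℕP
open import Data.Integer as ℤ using (ℤ)
import Data.Integer.Properties as ℤP
open import Data.Fin using (Fin)
import Data.Fin.Properties as FinP
open import Data.List using (List; []; _∷_; filter; length; upTo; map; concatMap; applyUpTo)
import Data.List.Membership.DecPropositional as DecMem

interval : ℕ → List ℕ
interval r = map suc (upTo r)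

-- The subset of {1,...,r} receiving colour k under the colouring c : ℕ → Fin 3
-- (a duplicate-free list; the colouring is only relevant on 1..r).
colourClass : (r : ℕ) → (ℕ → Fin 3) → Fin 3 → List ℕ
colourClass r c k = filter (λ x → c x FinP.≟ k) (interval r)

sums : List ℕ → List ℕ
sums A = concatMap (λ x → map (λ y → x + y) A) A

diffs : List ℕ → List ℤ
diffs A = concatMap (λ x → map (λ y → ℤ.+ x ℤ.- ℤ.+ y) A) A

intRange : ℕ → List ℤ
intRange m = applyUpTo (λ i → ℤ.+ i ℤ.- ℤ.+ m) (suc (2 * m))

-- |A + A| for A ⊆ {0..b}: count the s ∈ [0, 2b] lying in A + A.
sumsetSize : (b : ℕ) → List ℕ → ℕ
sumsetSize b A = length (filter (λ s → s ∈? sums A) (upTo (suc (2 * b))))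
  where open DecMem ℕP._≟_ using (_∈?_)

-- |A - A| for A ⊆ {0..b}: count the d ∈ [-b, b] lying in A - A.
diffsetSize : (b : ℕ) → List ℕ → ℕ
diffsetSize b A = length (filter (λ d → d ∈? diffs A) (intRange b))
  where open DecMem ℤP._≟_ using (_∈?_)

MSTD : (r : ℕ) → List ℕ → Set
MSTD r A = sumsetSize r A > diffsetSize r A

-- c : ℕ → Fin 3 encodes a partition of {1..r} into three (colour) classes;
-- it is a partition into three MSTD subsets if every class is nonempty and MSTD.
-- (MSTD already forces nonemptiness, but we state it explicitly.)
ThreeMSTDPartition : ℕ → (ℕ → Fin 3) → Set
ThreeMSTDPartition r c = (k : Fin 3) → length (colourClass r c k) > 0 × MSTD r (colourClass r c k)
  where open import Data.Product using (_×_)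

-- Start from an explicit partition of {1, …, 72} into MSTD classes 0, 1, 2 with
-- class 0 ⊆ [1, 17], class 1 ⊆ [56, 72] and [18, 55] ⊆ class 2 (the base case is
-- verified by evaluation).  For r = 72 + K stretch it: keep positions 1..36,
-- insert K new positions coloured 2 after 36, and shift 37..72 up by K.
-- Count A + A and A − A of each class over three windows of indices.  In the
-- outer windows every sum or difference only uses the low block 1..36 and the
-- shifted high block, so these counts do not depend on K.  In the middle window
-- class 2, which contains the long interval [18, 55 + K], attains everything,
-- while the short classes 0 and 1 attain exactly what they attained for K = 0.
-- So for each class |A + A| and |A − A| grow by the same amount (2K for class 2,
-- 0 otherwise), and the MSTD property carries over from K = 0.
module Submission where

open import Defs
open import Data.Nat
open import Data.Nat.Properties
open import Data.Nat.Tactic.RingSolver using (solve-∀)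
import Data.Integer as ℤ
import Data.Integer.Properties as ℤ
import Data.Integer.Tactic.RingSolver as ℤ-Solver
open import Data.List using (List; []; _∷_; length; filter; map; applyUpTo; upTo)
open import Data.Bool using (T; true; false; if_then_else_)
open import Data.Bool.ListAction using (any)
open import Data.Fin using (Fin; zero; suc)
import Data.Fin.Properties as Fin
open import Data.List.Membership.Propositional using (_∈_; find; lose)
open import Data.List.Membership.Propositional.Properties
  using (∈-map⁺; ∈-map⁻; ∈-concatMap⁺; ∈-concatMap⁻; ∈-filter⁺; ∈-filter⁻; ∈-upTo⁺; ∈-upTo⁻; ∈-length)
import Data.List.Membership.DecPropositional as DecMembership
open import Data.Product using (∃; ∃₂; ∃-syntax; _×_; _,_; proj₁; proj₂)
open import Function using (_∘_)
open import Function.Bundles using (_⇔_; mk⇔; Equivalence)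
import Function.Properties.Equivalence as ⇔
open import Level using (0ℓ)
open import Relation.Nullary using (¬_; yes; no; contradiction)
open import Relation.Unary using (Pred; Decidable)
open import Relation.Binary.PropositionalEquality

open Equivalence using (to; from)

count : {A : Set} {P : Pred A 0ℓ} → Decidable P → (ℕ → A) → ℕ → ℕ
count P? f n = length (filter P? (applyUpTo f n))

module _ {A : Set} {P : Pred A 0ℓ} (P? : Decidable P) where

  count-+ : ∀ f m n → count P? f (m + n) ≡ count P? f m + count P? (λ j → f (m + j)) n
  count-+ f zero    n = refl
  count-+ f (suc m) n with P? (f 0)
  ... | yes _ = cong suc (count-+ (f ∘ suc) m n)
  ... | no _  = count-+ (f ∘ suc) m n

  count-+₃ : ∀ f a m c → count P? f (a + (m + c)) ≡
    count P? f a + (count P? (λ j → f (a + j)) m + count P? (λ j → f (a + (m + j))) c)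
  count-+₃ f a m c =
    trans (count-+ f a (m + c)) (cong (count P? f a +_) (count-+ (λ j → f (a + j)) m c))

  count-all : ∀ f n → (∀ j → j < n → P (f j)) → count P? f n ≡ n
  count-all f zero    all = refl
  count-all f (suc n) all with P? (f 0)
  ... | yes p = cong suc (count-all (f ∘ suc) n (λ j j<n → all (suc j) (s<s j<n)))
  ... | no ¬p = contradiction (all 0 z<s) ¬p

  count-none : ∀ f n → (∀ j → j < n → ¬ P (f j)) → count P? f n ≡ 0
  count-none f zero    none = refl
  count-none f (suc n) none with P? (f 0)
  ... | yes p = contradiction p (none 0 z<s)
  ... | no ¬p = count-none (f ∘ suc) n (λ j j<n → none (suc j) (s<s j<n))

count-cong : {A B : Set} {P : Pred A 0ℓ} {Q : Pred B 0ℓ} (P? : Decidable P) (Q? : Decidable Q) →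
  ∀ f g n → (∀ j → j < n → P (f j) ⇔ Q (g j)) → count P? f n ≡ count Q? g n
count-cong P? Q? f g zero    equiv = refl
count-cong P? Q? f g (suc n) equiv with P? (f 0) | Q? (g 0)
... | yes p | yes q = cong suc (count-cong P? Q? (f ∘ suc) (g ∘ suc) n (λ j j<n → equiv (suc j) (s<s j<n)))
... | no ¬p | no ¬q = count-cong P? Q? (f ∘ suc) (g ∘ suc) n (λ j j<n → equiv (suc j) (s<s j<n))
... | yes p | no ¬q = contradiction (to (equiv 0 z<s) p) ¬q
... | no ¬p | yes q = contradiction (from (equiv 0 z<s) q) ¬p

numeral-≤ : ∀ {m n} {m≤ᵇn : T (m ≤ᵇ n)} → m ≤ n
numeral-≤ {m} {n} {m≤ᵇn} = ≤ᵇ⇒≤ m n m≤ᵇn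

exchange : ∀ p q r → p + (q + r) ≡ q + (p + r)
exchange = solve-∀

swap-outer : ∀ p q r → (p + q) + r ≡ (r + q) + p
swap-outer = solve-∀

≤-offset : ∀ {m n} d → m + d ≡ n → m ≤ n
≤-offset {m} d refl = m≤m+n m d

shifted⇔ : ∀ {l r l' r'} m → l' ≡ l + m → r' ≡ r + m → (l' ≡ r') ⇔ (l ≡ r)
shifted⇔ {l} {r} m refl refl = mk⇔ (+-cancelʳ-≡ m l r) (cong (_+ m))

summand-bound : ∀ {x y t b c} → x + y ≡ t → y ≤ b → c + b ≤ t → c ≤ x
summand-bound {x} {y} {t} {b} {c} x+y≡t y≤b c+b≤t =
  +-cancelʳ-≤ b c x (≤-trans c+b≤t (subst (_≤ x + b) x+y≡t (+-monoʳ-≤ x y≤b)))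

IsSum : List ℕ → ℕ → Set
IsSum A s = ∃₂ λ x y → x ∈ A × y ∈ A × x + y ≡ s

-- The integer i − b equals x − y for some x, y ∈ A (stated inside ℕ).
IsDiff : List ℕ → ℕ → ℕ → Set
IsDiff A b i = ∃₂ λ x y → x ∈ A × y ∈ A × x + b ≡ i + y

sums⇔ : ∀ {A s} → s ∈ sums A ⇔ IsSum A s
sums⇔ {A} = mk⇔ split (λ (x , y , x∈A , y∈A , x+y≡s) → subst (_∈ sums A) x+y≡s (combine x∈A y∈A))
  where
  combine : ∀ {x y} → x ∈ A → y ∈ A → x + y ∈ sums A
  combine {x} x∈A y∈A = ∈-concatMap⁺ (λ x → map (x +_) A) (lose x∈A (∈-map⁺ (x +_) y∈A))
  split : ∀ {s} → s ∈ sums A → IsSum A s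
  split s∈ with find (∈-concatMap⁻ (λ x → map (x +_) A) {xs = A} s∈)
  ... | x , x∈A , s∈row with ∈-map⁻ (x +_) s∈row
  ...   | y , y∈A , s≡x+y = x , y , x∈A , y∈A , sym s≡x+y

diff≡⇔ : ∀ x y i b → (ℤ.+ x ℤ.- ℤ.+ y ≡ ℤ.+ i ℤ.- ℤ.+ b) ⇔ (x + b ≡ i + y)
diff≡⇔ x y i b = mk⇔ forward backward
  where
  open ≡-Reasoning
  forward : ℤ.+ x ℤ.- ℤ.+ y ≡ ℤ.+ i ℤ.- ℤ.+ b → x + b ≡ i + y
  forward e = ℤ.+-injective (begin
    ℤ.+ x ℤ.+ ℤ.+ b                          ≡⟨ shift (ℤ.+ x) (ℤ.+ y) (ℤ.+ b) ⟩
    (ℤ.+ x ℤ.- ℤ.+ y) ℤ.+ (ℤ.+ y ℤ.+ ℤ.+ b)  ≡⟨ cong (ℤ._+ (ℤ.+ y ℤ.+ ℤ.+ b)) e ⟩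
    (ℤ.+ i ℤ.- ℤ.+ b) ℤ.+ (ℤ.+ y ℤ.+ ℤ.+ b)  ≡⟨ unshift (ℤ.+ i) (ℤ.+ b) (ℤ.+ y) ⟩
    ℤ.+ i ℤ.+ ℤ.+ y                          ∎)
    where
    shift : ∀ p q r → p ℤ.+ r ≡ (p ℤ.- q) ℤ.+ (q ℤ.+ r)
    shift = ℤ-Solver.solve-∀
    unshift : ∀ p q r → (p ℤ.- q) ℤ.+ (r ℤ.+ q) ≡ p ℤ.+ r
    unshift = ℤ-Solver.solve-∀
  backward : x + b ≡ i + y → ℤ.+ x ℤ.- ℤ.+ y ≡ ℤ.+ i ℤ.- ℤ.+ b
  backward e = begin
    ℤ.+ x ℤ.- ℤ.+ y                              ≡⟨ extend (ℤ.+ x) (ℤ.+ y) (ℤ.+ b) ⟩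
    (ℤ.+ x ℤ.+ ℤ.+ b) ℤ.- (ℤ.+ y ℤ.+ ℤ.+ b)      ≡⟨ cong (ℤ._- (ℤ.+ y ℤ.+ ℤ.+ b)) (cong ℤ.+_ e) ⟩
    (ℤ.+ i ℤ.+ ℤ.+ y) ℤ.- (ℤ.+ y ℤ.+ ℤ.+ b)      ≡⟨ reduce (ℤ.+ i) (ℤ.+ y) (ℤ.+ b) ⟩
    ℤ.+ i ℤ.- ℤ.+ b                              ∎
    where
    extend : ∀ p q r → p ℤ.- q ≡ (p ℤ.+ r) ℤ.- (q ℤ.+ r)
    extend = ℤ-Solver.solve-∀
    reduce : ∀ p q r → (p ℤ.+ q) ℤ.- (q ℤ.+ r) ≡ p ℤ.- r
    reduce = ℤ-Solver.solve-∀

diffs⇔ : ∀ {A b i} → ℤ.+ i ℤ.- ℤ.+ b ∈ diffs A ⇔ IsDiff A b i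
diffs⇔ {A} {b} {i} = mk⇔ split join
  where
  difference : ℕ → ℕ → ℤ.ℤ
  difference x y = ℤ.+ x ℤ.- ℤ.+ y
  join : IsDiff A b i → ℤ.+ i ℤ.- ℤ.+ b ∈ diffs A
  join (x , y , x∈A , y∈A , e) =
    subst (_∈ diffs A) (from (diff≡⇔ x y i b) e)
      (∈-concatMap⁺ (λ x → map (difference x) A) (lose x∈A (∈-map⁺ (difference x) y∈A)))
  split : ℤ.+ i ℤ.- ℤ.+ b ∈ diffs A → IsDiff A b i
  split d∈ with find (∈-concatMap⁻ (λ x → map (difference x) A) {xs = A} d∈)
  ... | x , x∈A , d∈row with ∈-map⁻ (difference x) d∈row
  ...   | y , y∈A , d≡x-y = x , y , x∈A , y∈A , to (diff≡⇔ x y i b) (sym d≡x-y)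

sum? : (A : List ℕ) → Decidable (_∈ sums A)
sum? A s = s ∈? sums A
  where open DecMembership _≟_ using (_∈?_)

diff? : (A : List ℕ) → Decidable (_∈ diffs A)
diff? A d = d ∈? diffs A
  where open DecMembership ℤ._≟_ using (_∈?_)

sums-cong : ∀ {A A' s s'} → IsSum A s ⇔ IsSum A' s' → s ∈ sums A ⇔ s' ∈ sums A'
sums-cong e = ⇔.trans sums⇔ (⇔.trans e (⇔.sym sums⇔))

diffs-cong : ∀ {A A' b b' i i'} → IsDiff A b i ⇔ IsDiff A' b' i' →
  ℤ.+ i ℤ.- ℤ.+ b ∈ diffs A ⇔ ℤ.+ i' ℤ.- ℤ.+ b' ∈ diffs A'
diffs-cong e = ⇔.trans diffs⇔ (⇔.trans e (⇔.sym diffs⇔))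

diff-symmetric : ∀ {A b i i'} → i + i' ≡ b + b → IsDiff A b i → IsDiff A b i'
diff-symmetric {A} {b} {i} {i'} i+i'≡2b (x , y , x∈A , y∈A , e) =
  y , x , y∈A , x∈A , +-cancelˡ-≡ i (y + b) (i' + x) (begin
    i + (y + b)   ≡⟨ sym (+-assoc i y b) ⟩
    (i + y) + b   ≡⟨ cong (_+ b) (sym e) ⟩
    (x + b) + b   ≡⟨ +-assoc x b b ⟩
    x + (b + b)   ≡⟨ cong (x +_) (sym i+i'≡2b) ⟩
    x + (i + i')  ≡⟨ rotate x i i' ⟩
    i + (i' + x)  ∎)
  where
  open ≡-Reasoning
  rotate : ∀ p q r → p + (q + r) ≡ q + (r + p)
  rotate = solve-∀

ContainsInterval : ℕ → ℕ → List ℕ → Set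
ContainsInterval a b A = ∀ {x} → a ≤ x → x ≤ b → x ∈ A

double-cancel-≤ : ∀ {a b} → a + a ≤ b + b → a ≤ b
double-cancel-≤ {a} {b} 2a≤2b with a ≤? b
... | yes a≤b = a≤b
... | no a≰b = contradiction 2a≤2b (<⇒≱ (+-mono-< (≰⇒> a≰b) (≰⇒> a≰b)))

-- If [a, b] ⊆ A then [a + a, b + b] ⊆ A + A: write s = a + t or s = t + b with t ∈ [a, b].
interval-sums : ∀ {a b A s} → ContainsInterval a b A → a + a ≤ s → s ≤ b + b → IsSum A s
interval-sums {a} {b} {A} {s} [a,b]⊆A 2a≤s s≤2b with s ≤? a + b
... | yes s≤a+b = from-left (m≤n⇒∃[o]m+o≡n (≤-trans (m≤m+n a a) 2a≤s))
  where
  from-left : (∃ λ t → a + t ≡ s) → IsSum A s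
  from-left (t , refl) =
    a , t , [a,b]⊆A ≤-refl (double-cancel-≤ (≤-trans 2a≤s s≤2b)) ,
    [a,b]⊆A (+-cancelˡ-≤ a a t 2a≤s) (+-cancelˡ-≤ a t b s≤a+b) , refl
... | no s≰a+b = from-right (m≤n⇒∃[o]m+o≡n (≤-trans (m≤m+n b a) (<⇒≤ b+a<s)))
  where
  b+a<s : b + a < s
  b+a<s = subst (_< s) (+-comm a b) (≰⇒> s≰a+b)
  from-right : (∃ λ t → b + t ≡ s) → IsSum A s
  from-right (t , refl) =
    t , b , [a,b]⊆A (+-cancelˡ-≤ b a t (<⇒≤ b+a<s)) (+-cancelˡ-≤ b t b s≤2b) ,
    [a,b]⊆A (double-cancel-≤ (≤-trans 2a≤s s≤2b)) ≤-refl , +-comm t b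

-- If [a, b] ⊆ A then every i with |i − B| ≤ b − a gives a difference i − B ∈ A − A:
-- take (a, a + t) when B = i + t, and (a + t, a) when i = B + t.
interval-diffs : ∀ {a b A B i} → ContainsInterval a b A → i + a ≤ B + b → B + a ≤ i + b → IsDiff A B i
interval-diffs {a} {b} {A} {B} {i} [a,b]⊆A i+a≤B+b B+a≤i+b with i ≤? B
... | yes i≤B = below (m≤n⇒∃[o]m+o≡n i≤B)
  where
  below : (∃ λ t → i + t ≡ B) → IsDiff A B i
  below (t , refl) = a , a + t , [a,b]⊆A ≤-refl (≤-trans (m≤m+n a t) a+t≤b) , [a,b]⊆A (m≤m+n a t) a+t≤b , exchange a i t
    where
    a+t≤b : a + t ≤ b
    a+t≤b = subst (_≤ b) (+-comm t a) (+-cancelˡ-≤ i (t + a) b (subst (_≤ i + b) (+-assoc i t a) B+a≤i+b))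
... | no i≰B = above (m≤n⇒∃[o]m+o≡n (<⇒≤ (≰⇒> i≰B)))
  where
  above : (∃ λ t → B + t ≡ i) → IsDiff A B i
  above (t , refl) = a + t , a , [a,b]⊆A (m≤m+n a t) a+t≤b , [a,b]⊆A ≤-refl (≤-trans (m≤m+n a t) a+t≤b) , swap-outer a t B
    where
    a+t≤b : a + t ≤ b
    a+t≤b = subst (_≤ b) (+-comm t a) (+-cancelˡ-≤ B (t + a) b (subst (_≤ B + b) (+-assoc B t a) i+a≤B+b))

Within : ℕ → ℕ → List ℕ → Set
Within lo hi A = ∀ {x} → x ∈ A → lo ≤ x × x ≤ hi

sum-within : ∀ {lo hi A s} → Within lo hi A → IsSum A s → lo + lo ≤ s × s ≤ hi + hi
sum-within A⊆ (x , y , x∈A , y∈A , refl) =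
  +-mono-≤ (proj₁ (A⊆ x∈A)) (proj₁ (A⊆ y∈A)) , +-mono-≤ (proj₂ (A⊆ x∈A)) (proj₂ (A⊆ y∈A))

diff-within : ∀ {lo w A b i} → Within lo (lo + w) A → IsDiff A b i → i ≤ b + w × b ≤ i + w
diff-within {lo} {w} {A} {b} {i} A⊆ (x , y , x∈A , y∈A , e) = i≤b+w , b≤i+w
  where
  open ≤-Reasoning
  swap-inner : ∀ p q r → p + (q + r) ≡ (p + r) + q
  swap-inner = solve-∀
  i≤b+w : i ≤ b + w
  i≤b+w = +-cancelʳ-≤ lo i (b + w) (begin
    i + lo        ≤⟨ +-monoʳ-≤ i (proj₁ (A⊆ y∈A)) ⟩
    i + y         ≡⟨ sym e ⟩
    x + b         ≤⟨ +-monoˡ-≤ b (proj₂ (A⊆ x∈A)) ⟩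
    (lo + w) + b  ≡⟨ swap-outer lo w b ⟩
    (b + w) + lo  ∎)
  b≤i+w : b ≤ i + w
  b≤i+w = +-cancelʳ-≤ lo b (i + w) (begin
    b + lo        ≤⟨ +-monoʳ-≤ b (proj₁ (A⊆ x∈A)) ⟩
    b + x         ≡⟨ +-comm b x ⟩
    x + b         ≡⟨ e ⟩
    i + y         ≤⟨ +-monoʳ-≤ i (proj₂ (A⊆ y∈A)) ⟩
    i + (lo + w)  ≡⟨ swap-inner i lo w ⟩
    (i + w) + lo  ∎)

∈-colourClass : ∀ {r c k x} → x ∈ colourClass r c k ⇔ (1 ≤ x × x ≤ r × c x ≡ k)
∈-colourClass {r} {c} {k} = mk⇔ split join
  where
  split : ∀ {x} → x ∈ colourClass r c k → 1 ≤ x × x ≤ r × c x ≡ k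
  split x∈ with ∈-filter⁻ (λ x → c x Fin.≟ k) {xs = interval r} x∈
  ... | x∈interval , cx≡k with ∈-map⁻ suc {xs = upTo r} x∈interval
  ...   | _ , x'<r , refl = s≤s z≤n , ∈-upTo⁻ x'<r , cx≡k
  join : ∀ {x} → 1 ≤ x × x ≤ r × c x ≡ k → x ∈ colourClass r c k
  join {suc x} (_ , x<r , cx≡k) = ∈-filter⁺ (λ x → c x Fin.≟ k) (∈-map⁺ suc (∈-upTo⁺ x<r)) cx≡k

one two : Fin 3
one = suc zero
two = suc (suc zero)

-- The base partition of {1, …, 72}: class 0 is L₀, class 1 is 55 + L₁, class 2 is the rest.
L₀ L₁ : List ℕ
L₀ = 1 ∷ 3 ∷ 4 ∷ 8 ∷ 9 ∷ 10 ∷ 12 ∷ 15 ∷ 16 ∷ 17 ∷ []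
L₁ = 1 ∷ 2 ∷ 3 ∷ 5 ∷ 8 ∷ 9 ∷ 10 ∷ 14 ∷ 16 ∷ 17 ∷ []

mark : List ℕ → Fin 3 → ℕ → Fin 3
mark L k x = if any (x ≡ᵇ_) L then k else two

mark-only : ∀ L k x {k'} → k ≢ k' → two ≢ k' → mark L k x ≢ k'
mark-only L k x k≢k' two≢k' with any (x ≡ᵇ_) L
... | true  = k≢k'
... | false = two≢k'

base : ℕ → Fin 3
base x with x ≤? 17 | x ≤? 55
... | yes _ | _     = mark L₀ zero x
... | no  _ | yes _ = two
... | no  _ | no  _ = mark L₁ one (x ∸ 55)

base-zero : ∀ {x} → base x ≡ zero → x ≤ 17
base-zero {x} e with x ≤? 17 | x ≤? 55
... | yes x≤17 | _     = x≤17
... | no  _    | yes _ = contradiction e λ ()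
... | no  _    | no  _ = contradiction e (mark-only L₁ one (x ∸ 55) (λ ()) (λ ()))

base-one : ∀ {x} → base x ≡ one → 55 < x
base-one {x} e with x ≤? 17 | x ≤? 55
... | yes _ | _        = contradiction e (mark-only L₀ zero x (λ ()) (λ ()))
... | no  _ | yes _    = contradiction e λ ()
... | no  _ | no x≰55  = ≰⇒> x≰55

base-two : ∀ {x} → 17 < x → x ≤ 55 → base x ≡ two
base-two {x} 17<x x≤55 with x ≤? 17 | x ≤? 55
... | yes x≤17 | _       = contradiction x≤17 (<⇒≱ 17<x)
... | no  _    | yes _   = refl
... | no  _    | no x≰55 = contradiction x≤55 x≰55

stretched : ℕ → ℕ → Fin 3
stretched K x with x ≤? 36 | x ≤? 36 + K
... | yes _ | _     = base x
... | no  _ | yes _ = two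
... | no  _ | no  _ = base (x ∸ K)

stretched-low : ∀ K {x} → x ≤ 36 → stretched K x ≡ base x
stretched-low K {x} x≤36 with x ≤? 36 | x ≤? 36 + K
... | yes _ | _     = refl
... | no x≰36 | _   = contradiction x≤36 x≰36

stretched-gap : ∀ K {x} → 36 < x → x ≤ 36 + K → stretched K x ≡ two
stretched-gap K {x} 36<x x≤36+K with x ≤? 36 | x ≤? 36 + K
... | yes x≤36 | _        = contradiction x≤36 (<⇒≱ 36<x)
... | no _ | yes _        = refl
... | no _ | no x≰36+K    = contradiction x≤36+K x≰36+K

stretched-high : ∀ K {x} → 36 < x → stretched K (x + K) ≡ base x
stretched-high K {x} 36<x with x + K ≤? 36 | x + K ≤? 36 + K
... | yes x+K≤36 | _  = contradiction (≤-trans (m≤m+n x K) x+K≤36) (<⇒≱ 36<x)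
... | no _ | yes x+K≤36+K = contradiction (+-cancelʳ-≤ K x 36 x+K≤36+K) (<⇒≱ 36<x)
... | no _ | no _     = cong base (m+n∸n≡m x K)

data Position (K : ℕ) : ℕ → Set where
  low  : ∀ {x} → x ≤ 36 → Position K x
  gap  : ∀ {x} → 36 < x → x ≤ 36 + K → Position K x
  high : ∀ {x} → 36 < x → Position K (x + K)

position : ∀ K x → Position K x
position K x with x ≤? 36 | x ≤? 36 + K
... | yes x≤36 | _          = low x≤36
... | no x≰36  | yes x≤36+K = gap (≰⇒> x≰36) x≤36+K
... | no _     | no x≰36+K  =
  subst (Position K) (m∸n+n≡m K≤x) (high (+-cancelʳ-< K 36 (x ∸ K) (subst (36 + K <_) (sym (m∸n+n≡m K≤x)) 36+K<x)))
  where
  36+K<x : 36 + K < x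
  36+K<x = ≰⇒> x≰36+K
  K≤x : K ≤ x
  K≤x = ≤-trans (m≤n+m K 36) (<⇒≤ 36+K<x)

above-gap : ∀ K {y} → 36 + K < y → ∃ λ y' → 36 < y' × y ≡ y' + K
above-gap K {y} 36+K<y with position K y
... | low y≤36       = contradiction (≤-trans y≤36 (m≤m+n 36 K)) (<⇒≱ 36+K<y)
... | gap _ y≤36+K   = contradiction y≤36+K (<⇒≱ 36+K<y)
... | high {y'} 36<y' = y' , 36<y' , refl

stretched-zero : ∀ K {x} → stretched K x ≡ zero → x ≤ 17
stretched-zero K {x} e with position K x
... | low x≤36       = base-zero (trans (sym (stretched-low K x≤36)) e)
... | gap 36<x x≤36+K = contradiction (trans (sym (stretched-gap K 36<x x≤36+K)) e) λ ()
... | high 36<x'     = contradiction (base-zero (trans (sym (stretched-high K 36<x')) e))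
                                     (<⇒≱ (≤-<-trans (numeral-≤ {17} {36}) 36<x'))

stretched-one : ∀ K {x} → stretched K x ≡ one → 55 + K < x
stretched-one K {x} e with position K x
... | low x≤36       = contradiction (base-one (trans (sym (stretched-low K x≤36)) e))
                                     (≤⇒≯ (≤-trans x≤36 (numeral-≤ {36} {55})))
... | gap 36<x x≤36+K = contradiction (trans (sym (stretched-gap K 36<x x≤36+K)) e) λ ()
... | high 36<x'     = +-monoˡ-< K (base-one (trans (sym (stretched-high K 36<x')) e))

stretched-two : ∀ K {x} → 17 < x → x ≤ 55 + K → stretched K x ≡ two
stretched-two K {x} 17<x x≤55+K with position K x
... | low x≤36        = trans (stretched-low K x≤36) (base-two 17<x (≤-trans x≤36 (numeral-≤ {36} {55})))
... | gap 36<x x≤36+K = stretched-gap K 36<x x≤36+K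
... | high {x'} 36<x' = trans (stretched-high K 36<x')
                          (base-two (≤-<-trans (numeral-≤ {17} {36}) 36<x') (+-cancelʳ-≤ K x' 55 x≤55+K))

-- The
-- definition is opaque so that K and k stay visible in types; it is unfolded
-- only to relate it to colourClass and to the explicit base partition.
opaque
  Class : ℕ → Fin 3 → List ℕ
  Class K k = colourClass (72 + K) (stretched K) k

opaque
  unfolding Class

  Class-def : ∀ K k → Class K k ≡ colourClass (72 + K) (stretched K) k
  Class-def K k = refl

  ∈-Class : ∀ {K k x} → x ∈ Class K k ⇔ (1 ≤ x × x ≤ 72 + K × stretched K x ≡ k)
  ∈-Class {K} {k} = ∈-colourClass {72 + K} {stretched K} {k}

Class-bounds : ∀ {K k x} → x ∈ Class K k → 1 ≤ x × x ≤ 72 + K × stretched K x ≡ k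
Class-bounds = to ∈-Class

Class-upper : ∀ {K k x} → x ∈ Class K k → x ≤ 72 + K
Class-upper x∈ = proj₁ (proj₂ (Class-bounds x∈))

Class-low : ∀ {K K' k x} → x ≤ 36 → x ∈ Class K k → x ∈ Class K' k
Class-low {K} {K'} {k} {x} x≤36 x∈ with Class-bounds x∈
... | 1≤x , _ , colour = from ∈-Class
  (1≤x , ≤-trans x≤36 (≤-trans (numeral-≤ {36} {72}) (m≤m+n 72 K')) ,
   trans (stretched-low K' x≤36) (trans (sym (stretched-low K x≤36)) colour))

Class-shift : ∀ {K K' k x} → 36 < x → x + K ∈ Class K k → x + K' ∈ Class K' k
Class-shift {K} {K'} {k} {x} 36<x x∈ with Class-bounds x∈
... | _ , x+K≤72+K , colour = from ∈-Class
  (≤-trans (s≤s z≤n) (≤-trans (<⇒≤ 36<x) (m≤m+n x K')) , +-monoˡ-≤ K' (+-cancelʳ-≤ K x 72 x+K≤72+K) ,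
   trans (stretched-high K' 36<x) (trans (sym (stretched-high K 36<x)) colour))

Class-two-interval : ∀ K → ContainsInterval 18 (55 + K) (Class K two)
Class-two-interval K 18≤x x≤55+K = from ∈-Class
  (≤-trans (s≤s z≤n) 18≤x , ≤-trans x≤55+K (+-monoˡ-≤ K (numeral-≤ {55} {72})) , stretched-two K 18≤x x≤55+K)

Class-zero-within : ∀ K → Within 1 (1 + 16) (Class K zero)
Class-zero-within K x∈ with Class-bounds x∈
... | 1≤x , _ , colour = 1≤x , stretched-zero K colour

Class-one-within : ∀ K → Within (56 + K) ((56 + K) + 16) (Class K one)
Class-one-within K {x} x∈ with Class-bounds x∈
... | _ , x≤72+K , colour = stretched-one K colour , subst (x ≤_) (top K) x≤72+K
  where
  top : ∀ K → 72 + K ≡ (56 + K) + 16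
  top = solve-∀

-- Sums up to 36 only use the low block, so they do not depend on K.
sums-bottom : ∀ {K K' k s} → s ≤ 36 → IsSum (Class K k) s → IsSum (Class K' k) s
sums-bottom s≤36 (x , y , x∈ , y∈ , refl) =
  x , y , Class-low (≤-trans (m≤m+n x _) s≤36) x∈ , Class-low (≤-trans (m≤n+m y _) s≤36) y∈ , refl

top-summand : ∀ {K k s x y} → 109 ≤ s → x + y ≡ s + (K + K) → y ∈ Class K k → 36 + K < x
top-summand {K} {k} {s} 109≤s x+y≡ y∈ =
  summand-bound x+y≡ (Class-upper y∈) (subst (_≤ s + (K + K)) (sym (lower-sum K)) (+-monoˡ-≤ (K + K) 109≤s))
  where
  lower-sum : ∀ K → suc (36 + K) + (72 + K) ≡ 109 + (K + K)
  lower-sum = solve-∀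

pair⇔ : ∀ a b s m → ((a + m) + (b + m) ≡ s + (m + m)) ⇔ (a + b ≡ s)
pair⇔ a b s m = shifted⇔ (m + m) (pair-shift a b m) refl
  where
  pair-shift : ∀ a b m → (a + m) + (b + m) ≡ (a + b) + (m + m)
  pair-shift = solve-∀

-- Sums from 109 + 2K on only use the shifted high block, so they move by 2K.
sums-top : ∀ {K K' k s t t'} → 109 ≤ s → t ≡ s + (K + K) → t' ≡ s + (K' + K') →
  IsSum (Class K k) t → IsSum (Class K' k) t'
sums-top {K} {K'} {k} {s} 109≤s refl refl (x , y , x∈ , y∈ , e) =
  rebuild (above-gap K (top-summand 109≤s e y∈)) (above-gap K (top-summand 109≤s (trans (+-comm y x) e) x∈))
  where
  rebuild : (∃ λ x' → 36 < x' × x ≡ x' + K) → (∃ λ y' → 36 < y' × y ≡ y' + K) → IsSum (Class K' k) (s + (K' + K'))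
  rebuild (x' , 36<x' , refl) (y' , 36<y' , refl) =
    x' + K' , y' + K' , Class-shift 36<x' x∈ , Class-shift 36<y' y∈ , from (pair⇔ x' y' s K') (to (pair⇔ x' y' s K) e)

left-low : ∀ {K x y i} → i ≤ 35 → x + (72 + K) ≡ i + y → y ≤ 72 + K → x ≤ 36
left-low {K} {x} {y} {i} i≤35 e y≤72+K =
  ≤-trans (+-cancelʳ-≤ (72 + K) x 35 (subst (_≤ 35 + (72 + K)) (sym e) (+-mono-≤ i≤35 y≤72+K))) (numeral-≤ {35} {36})

left-high : ∀ {K x y i} → i ≤ 35 → x + (72 + K) ≡ i + y → 36 + K < y
left-high {K} {x} {y} {i} i≤35 e =
  summand-bound (trans (+-comm y i) (sym e)) i≤35 (subst (_≤ x + (72 + K)) (sym (gap-width K)) (m≤n+m (72 + K) x))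
  where
  gap-width : ∀ K → suc (36 + K) + 35 ≡ 72 + K
  gap-width = solve-∀

single⇔ : ∀ x i y m → (x + (72 + m) ≡ i + (y + m)) ⇔ (x + 72 ≡ i + y)
single⇔ x i y m = shifted⇔ m (sym (+-assoc x 72 m)) (sym (+-assoc i y m))

diffs-left : ∀ {K K' k i} → i ≤ 35 → IsDiff (Class K k) (72 + K) i → IsDiff (Class K' k) (72 + K') i
diffs-left {K} {K'} {k} {i} i≤35 (x , y , x∈ , y∈ , e) = rebuild (above-gap K (left-high i≤35 e))
  where
  rebuild : (∃ λ y' → 36 < y' × y ≡ y' + K) → IsDiff (Class K' k) (72 + K') i
  rebuild (y' , 36<y' , refl) =
    x , y' + K' , Class-low (left-low i≤35 e (Class-upper y∈)) x∈ , Class-shift 36<y' y∈ ,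
    from (single⇔ x i y' K') (to (single⇔ x i y' K) e)

-- The rightmost 36 differences are the negatives of the leftmost ones, so they
-- do not depend on K either (up to the shift of the index by 2K).
diffs-right : ∀ {K K' k i t t'} → 109 ≤ i → i ≤ 144 → t ≡ i + (K + K) → t' ≡ i + (K' + K') →
  IsDiff (Class K k) (72 + K) t → IsDiff (Class K' k) (72 + K') t'
diffs-right {K} {K'} {k} {i} 109≤i i≤144 refl refl d = reflect (m≤n⇒∃[o]m+o≡n i≤144)
  where
  reflect : (∃ λ i' → i + i' ≡ 144) → IsDiff (Class K' k) (72 + K') (i + (K' + K'))
  reflect (i' , i+i'≡144) = diff-symmetric (trans (+-comm i' _) (mirror K')) (diffs-left i'≤35 (diff-symmetric (mirror K) d))
    where
    i'≤35 : i' ≤ 35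
    i'≤35 = +-cancelˡ-≤ 109 i' 35 (≤-trans (+-monoˡ-≤ i' 109≤i) (≤-reflexive i+i'≡144))
    regroup : ∀ a b m → (a + (m + m)) + b ≡ (a + b) + (m + m)
    regroup = solve-∀
    double : ∀ m → 144 + (m + m) ≡ (72 + m) + (72 + m)
    double = solve-∀
    mirror : ∀ m → (i + (m + m)) + i' ≡ (72 + m) + (72 + m)
    mirror m = trans (regroup i i' m) (trans (cong (_+ (m + m)) i+i'≡144) (double m))

-- Class two contains [18, 55 + K], so every sum 37 .. 108 + 2K is attained.
sums-middle-two : ∀ K {j} → j < 72 + 2 * K → IsSum (Class K two) (37 + j)
sums-middle-two K {j} j< = interval-sums (Class-two-interval K) (≤-trans (numeral-≤ {36} {37}) (m≤m+n 37 j))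
  (≤-trans (+-monoʳ-≤ 37 (<⇒≤ j<)) (≤-offset 1 (top K)))
  where
  top : ∀ K → 37 + (72 + 2 * K) + 1 ≡ (55 + K) + (55 + K)
  top = solve-∀

diffs-middle-two : ∀ K {j} → j < K + (73 + K) → IsDiff (Class K two) (72 + K) (36 + j)
diffs-middle-two K {j} j< = interval-diffs (Class-two-interval K)
  (≤-trans (+-monoˡ-≤ 18 (+-monoʳ-≤ 36 (<⇒≤ j<))) (≤-reflexive (upper K)))
  (≤-offset (1 + j) (lower K j))
  where
  upper : ∀ K → 36 + (K + (73 + K)) + 18 ≡ (72 + K) + (55 + K)
  upper = solve-∀
  lower : ∀ K j → (72 + K) + 18 + (1 + j) ≡ (36 + j) + (55 + K)
  lower = solve-∀

-- Class zero lies in [1, 17], so it has no sums from 37 on.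
no-middle-sums-zero : ∀ K j → ¬ IsSum (Class K zero) (37 + j)
no-middle-sums-zero K j σ = <⇒≱ (≤-trans (numeral-≤ {35} {37}) (m≤m+n 37 j)) (proj₂ (sum-within (Class-zero-within K) σ))

-- Class one lies in [56 + K, 72 + K], so it has no sums below 112 + 2K.
no-middle-sums-one : ∀ K {j} → j < 72 + 2 * K → ¬ IsSum (Class K one) (37 + j)
no-middle-sums-one K {j} j< σ =
  <⇒≱ (≤-trans (+-monoʳ-< 37 j<) (≤-offset 3 (bottom K))) (proj₁ (sum-within (Class-one-within K) σ))
  where
  bottom : ∀ K → 37 + (72 + 2 * K) + 3 ≡ (56 + K) + (56 + K)
  bottom = solve-∀

narrow-gap-left : ∀ {lo A K j} → Within lo (lo + 16) A → j < K → ¬ IsDiff A (72 + K) (36 + j)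
narrow-gap-left {lo} {A} {K} {j} A⊆ j<K δ = <⇒≱ too-low (proj₂ (diff-within A⊆ δ))
  where
  open ≤-Reasoning
  too-low : (36 + j) + 16 < 72 + K
  too-low = begin-strict
    (36 + j) + 16  ≡⟨ +-comm (36 + j) 16 ⟩
    52 + j         <⟨ +-monoʳ-< 52 j<K ⟩
    52 + K         ≤⟨ +-monoˡ-≤ K (numeral-≤ {52} {72}) ⟩
    72 + K         ∎

narrow-gap-right : ∀ {lo A K j} → Within lo (lo + 16) A → ¬ IsDiff A (72 + K) (36 + (K + (73 + j)))
narrow-gap-right {lo} {A} {K} {j} A⊆ δ = <⇒≱ (≤-offset (20 + j) (too-high K j)) (proj₁ (diff-within A⊆ δ))
  where
  too-high : ∀ K j → suc ((72 + K) + 16) + (20 + j) ≡ 36 + (K + (73 + j))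
  too-high = solve-∀

centre⇔ : ∀ x y j m → (x + (72 + m) ≡ (36 + (m + j)) + y) ⇔ (x + 72 ≡ (36 + j) + y)
centre⇔ x y j m = shifted⇔ m (sym (+-assoc x 72 m)) (regroup y j m)
  where
  regroup : ∀ y j m → (36 + (m + j)) + y ≡ ((36 + j) + y) + m
  regroup = solve-∀

centre-pair⇔ : ∀ x y j m → ((x + m) + (72 + m) ≡ (36 + (m + j)) + (y + m)) ⇔ (x + 72 ≡ (36 + j) + y)
centre-pair⇔ x y j m = shifted⇔ (m + m) (regroupˡ x m) (regroupʳ y j m)
  where
  regroupˡ : ∀ x m → (x + m) + (72 + m) ≡ (x + 72) + (m + m)
  regroupˡ = solve-∀
  regroupʳ : ∀ y j m → (36 + (m + j)) + (y + m) ≡ ((36 + j) + y) + (m + m)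
  regroupʳ = solve-∀

-- In the centre of the middle window, class zero (inside the low block) has
-- the same differences for every K.
diffs-centre-zero : ∀ {K K' j} → IsDiff (Class K zero) (72 + K) (36 + (K + j)) →
  IsDiff (Class K' zero) (72 + K') (36 + (K' + j))
diffs-centre-zero {K} {K'} {j} (x , y , x∈ , y∈ , e) =
  x , y , Class-low (small x∈) x∈ , Class-low (small y∈) y∈ , from (centre⇔ x y j K') (to (centre⇔ x y j K) e)
  where
  small : ∀ {z} → z ∈ Class K zero → z ≤ 36
  small z∈ = ≤-trans (proj₂ (Class-zero-within K z∈)) (numeral-≤ {17} {36})

-- ... and so does class one (inside the shifted high block).
diffs-centre-one : ∀ {K K' j} → IsDiff (Class K one) (72 + K) (36 + (K + j)) →
  IsDiff (Class K' one) (72 + K') (36 + (K' + j))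
diffs-centre-one {K} {K'} {j} (x , y , x∈ , y∈ , e) = rebuild (above-gap K (beyond x∈)) (above-gap K (beyond y∈))
  where
  beyond : ∀ {z} → z ∈ Class K one → 36 + K < z
  beyond z∈ = ≤-<-trans (+-monoˡ-≤ K (numeral-≤ {36} {55})) (proj₁ (Class-one-within K z∈))
  rebuild : (∃ λ x' → 36 < x' × x ≡ x' + K) → (∃ λ y' → 36 < y' × y ≡ y' + K) →
    IsDiff (Class K' one) (72 + K') (36 + (K' + j))
  rebuild (x' , 36<x' , refl) (y' , 36<y' , refl) =
    x' + K' , y' + K' , Class-shift 36<x' x∈ , Class-shift 36<y' y∈ ,
    from (centre-pair⇔ x' y' j K') (to (centre-pair⇔ x' y' j K) e)

sumsBottom : List ℕ → ℕ
sumsBottom A = count (sum? A) (λ s → s) 37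

sumsMiddle : ℕ → List ℕ → ℕ
sumsMiddle K A = count (sum? A) (37 +_) (72 + 2 * K)

sumsTop : ℕ → List ℕ → ℕ
sumsTop K A = count (sum? A) (λ j → 37 + ((72 + 2 * K) + j)) 36

sumset-windows : ∀ K A → sumsetSize (72 + K) A ≡ sumsBottom A + (sumsMiddle K A + sumsTop K A)
sumset-windows K A =
  trans (cong (count (sum? A) (λ s → s)) (width K)) (count-+₃ (sum? A) (λ s → s) 37 (72 + 2 * K) 36)
  where
  width : ∀ K → suc (2 * (72 + K)) ≡ 37 + ((72 + 2 * K) + 36)
  width = solve-∀

diffsLeft : ℕ → List ℕ → ℕ
diffsLeft K A = count (diff? A) (λ i → ℤ.+ i ℤ.- ℤ.+ (72 + K)) 36

diffsMiddle : ℕ → List ℕ → ℕ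
diffsMiddle K A = count (diff? A) (λ j → ℤ.+ (36 + j) ℤ.- ℤ.+ (72 + K)) (K + (73 + K))

diffsRight : ℕ → List ℕ → ℕ
diffsRight K A = count (diff? A) (λ j → ℤ.+ (36 + ((K + (73 + K)) + j)) ℤ.- ℤ.+ (72 + K)) 36

diffset-windows : ∀ K A → diffsetSize (72 + K) A ≡ diffsLeft K A + (diffsMiddle K A + diffsRight K A)
diffset-windows K A =
  trans (cong (count (diff? A) (λ i → ℤ.+ i ℤ.- ℤ.+ (72 + K))) (width K))
        (count-+₃ (diff? A) (λ i → ℤ.+ i ℤ.- ℤ.+ (72 + K)) 36 (K + (73 + K)) 36)
  where
  width : ∀ K → suc (2 * (72 + K)) ≡ 36 + ((K + (73 + K)) + 36)
  width = solve-∀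

sumsBottom-stable : ∀ K k → sumsBottom (Class K k) ≡ sumsBottom (Class 0 k)
sumsBottom-stable K k = count-cong (sum? (Class K k)) (sum? (Class 0 k)) _ _ 37
  (λ j j<37 → sums-cong (mk⇔ (sums-bottom (≤-pred j<37)) (sums-bottom (≤-pred j<37))))

sumsTop-stable : ∀ K k → sumsTop K (Class K k) ≡ sumsTop 0 (Class 0 k)
sumsTop-stable K k = count-cong (sum? (Class K k)) (sum? (Class 0 k)) _ _ 36 (λ j _ → sums-cong
  (mk⇔ (sums-top (m≤m+n 109 j) (top-index K j) (sym (+-identityʳ (109 + j))))
       (sums-top (m≤m+n 109 j) (sym (+-identityʳ (109 + j))) (top-index K j))))
  where
  top-index : ∀ K j → 37 + ((72 + 2 * K) + j) ≡ (109 + j) + (K + K)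
  top-index = solve-∀

diffsLeft-stable : ∀ K k → diffsLeft K (Class K k) ≡ diffsLeft 0 (Class 0 k)
diffsLeft-stable K k = count-cong (diff? (Class K k)) (diff? (Class 0 k)) _ _ 36
  (λ j j<36 → diffs-cong (mk⇔ (diffs-left (≤-pred j<36)) (diffs-left (≤-pred j<36))))

diffsRight-stable : ∀ K k → diffsRight K (Class K k) ≡ diffsRight 0 (Class 0 k)
diffsRight-stable K k = count-cong (diff? (Class K k)) (diff? (Class 0 k))
  (λ j → ℤ.+ (36 + ((K + (73 + K)) + j)) ℤ.- ℤ.+ (72 + K)) (λ j → ℤ.+ (109 + j) ℤ.- ℤ.+ 72) 36
  (λ j j<36 → diffs-cong {i = 36 + ((K + (73 + K)) + j)} {i' = 109 + j} (right⇔ j j<36))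
  where
  right-index : ∀ K j → 36 + ((K + (73 + K)) + j) ≡ (109 + j) + (K + K)
  right-index = solve-∀
  right⇔ : ∀ j → j < 36 → IsDiff (Class K k) (72 + K) (36 + ((K + (73 + K)) + j)) ⇔ IsDiff (Class 0 k) 72 (109 + j)
  right⇔ j j<36 = mk⇔ (diffs-right 109≤ ≤144 (right-index K j) (sym (+-identityʳ (109 + j))))
                      (diffs-right 109≤ ≤144 (sym (+-identityʳ (109 + j))) (right-index K j))
    where
    109≤ : 109 ≤ 109 + j
    109≤ = m≤m+n 109 j
    ≤144 : 109 + j ≤ 144
    ≤144 = +-monoʳ-≤ 109 (≤-pred j<36)

-- How much the stretch by K enlarges |A + A| and |A − A| of each class.
extra : Fin 3 → ℕ → ℕ
extra zero             K = 0
extra (suc zero)       K = 0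
extra (suc (suc zero)) K = K + K

sumsMiddle-two : ∀ K → sumsMiddle K (Class K two) ≡ 72 + 2 * K
sumsMiddle-two K = count-all (sum? (Class K two)) (37 +_) (72 + 2 * K) (λ j j< → from sums⇔ (sums-middle-two K j<))

sumsMiddle-zero : ∀ K → sumsMiddle K (Class K zero) ≡ 0
sumsMiddle-zero K = count-none (sum? (Class K zero)) (37 +_) (72 + 2 * K) (λ j _ σ → no-middle-sums-zero K j (to sums⇔ σ))

sumsMiddle-one : ∀ K → sumsMiddle K (Class K one) ≡ 0
sumsMiddle-one K = count-none (sum? (Class K one)) (37 +_) (72 + 2 * K) (λ j j< σ → no-middle-sums-one K j< (to sums⇔ σ))

sumsMiddle-growth : ∀ K k → sumsMiddle K (Class K k) ≡ sumsMiddle 0 (Class 0 k) + extra k K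
sumsMiddle-growth K zero             = trans (sumsMiddle-zero K) (cong (_+ 0) (sym (sumsMiddle-zero 0)))
sumsMiddle-growth K (suc zero)       = trans (sumsMiddle-one K) (cong (_+ 0) (sym (sumsMiddle-one 0)))
sumsMiddle-growth K (suc (suc zero)) =
  trans (sumsMiddle-two K) (trans (doubling K) (cong (_+ (K + K)) (sym (sumsMiddle-two 0))))
  where
  doubling : ∀ K → 72 + 2 * K ≡ 72 + (K + K)
  doubling = solve-∀

diffsMiddle-two : ∀ K → diffsMiddle K (Class K two) ≡ K + (73 + K)
diffsMiddle-two K = count-all (diff? (Class K two)) _ (K + (73 + K)) (λ j j< → from diffs⇔ (diffs-middle-two K j<))

-- A class of width 16 whose centre differences do not depend on K has the
-- same middle count for every K: the outer parts of the window are empty.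
diffsMiddle-narrow : ∀ {K k lo} → Within lo (lo + 16) (Class K k) →
  (∀ {j} → IsDiff (Class K k) (72 + K) (36 + (K + j)) → IsDiff (Class 0 k) 72 (36 + j)) →
  (∀ {j} → IsDiff (Class 0 k) 72 (36 + j) → IsDiff (Class K k) (72 + K) (36 + (K + j))) →
  diffsMiddle K (Class K k) ≡ diffsMiddle 0 (Class 0 k)
diffsMiddle-narrow {K} {k} narrow to-base from-base = begin
  diffsMiddle K (Class K k)
    ≡⟨ count-+₃ (diff? (Class K k)) window K 73 K ⟩
  count P? window K + (count P? (λ j → window (K + j)) 73 + count P? (λ j → window (K + (73 + j))) K)
    ≡⟨ cong₂ _+_ (count-none P? window K (λ j j<K δ → narrow-gap-left narrow j<K (to (diffs⇔ {i = 36 + j}) δ)))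
                 (cong₂ _+_ (count-cong P? (diff? (Class 0 k)) (λ j → window (K + j)) (λ j → ℤ.+ (36 + j) ℤ.- ℤ.+ 72) 73
                                         (λ j _ → diffs-cong {i = 36 + (K + j)} {i' = 36 + j} (mk⇔ to-base from-base)))
                            (count-none P? (λ j → window (K + (73 + j))) K (λ j _ δ → narrow-gap-right narrow (to (diffs⇔ {i = 36 + (K + (73 + j))}) δ)))) ⟩
  0 + (diffsMiddle 0 (Class 0 k) + 0)
    ≡⟨ +-identityʳ _ ⟩
  diffsMiddle 0 (Class 0 k) ∎
  where
  open ≡-Reasoning
  P? = diff? (Class K k)
  window : ℕ → ℤ.ℤ
  window j = ℤ.+ (36 + j) ℤ.- ℤ.+ (72 + K)

diffsMiddle-growth : ∀ K k → diffsMiddle K (Class K k) ≡ diffsMiddle 0 (Class 0 k) + extra k K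
diffsMiddle-growth K zero =
  trans (diffsMiddle-narrow (Class-zero-within K) diffs-centre-zero diffs-centre-zero) (sym (+-identityʳ _))
diffsMiddle-growth K (suc zero) =
  trans (diffsMiddle-narrow (Class-one-within K) diffs-centre-one diffs-centre-one) (sym (+-identityʳ _))
diffsMiddle-growth K (suc (suc zero)) =
  trans (diffsMiddle-two K) (trans (regroup K) (cong (_+ (K + K)) (sym (diffsMiddle-two 0))))
  where
  regroup : ∀ K → K + (73 + K) ≡ 73 + (K + K)
  regroup = solve-∀

move-extra : ∀ b m e t → b + ((m + e) + t) ≡ (b + (m + t)) + e
move-extra = solve-∀

sumset-growth : ∀ K k → sumsetSize (72 + K) (Class K k) ≡ sumsetSize 72 (Class 0 k) + extra k K
sumset-growth K k = begin
  sumsetSize (72 + K) (Class K k)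
    ≡⟨ sumset-windows K (Class K k) ⟩
  sumsBottom (Class K k) + (sumsMiddle K (Class K k) + sumsTop K (Class K k))
    ≡⟨ cong₂ _+_ (sumsBottom-stable K k) (cong₂ _+_ (sumsMiddle-growth K k) (sumsTop-stable K k)) ⟩
  sumsBottom (Class 0 k) + ((sumsMiddle 0 (Class 0 k) + extra k K) + sumsTop 0 (Class 0 k))
    ≡⟨ move-extra (sumsBottom (Class 0 k)) (sumsMiddle 0 (Class 0 k)) (extra k K) (sumsTop 0 (Class 0 k)) ⟩
  (sumsBottom (Class 0 k) + (sumsMiddle 0 (Class 0 k) + sumsTop 0 (Class 0 k))) + extra k K
    ≡⟨ cong (_+ extra k K) (sym (sumset-windows 0 (Class 0 k))) ⟩
  sumsetSize 72 (Class 0 k) + extra k K ∎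
  where open ≡-Reasoning

diffset-growth : ∀ K k → diffsetSize (72 + K) (Class K k) ≡ diffsetSize 72 (Class 0 k) + extra k K
diffset-growth K k = begin
  diffsetSize (72 + K) (Class K k)
    ≡⟨ diffset-windows K (Class K k) ⟩
  diffsLeft K (Class K k) + (diffsMiddle K (Class K k) + diffsRight K (Class K k))
    ≡⟨ cong₂ _+_ (diffsLeft-stable K k) (cong₂ _+_ (diffsMiddle-growth K k) (diffsRight-stable K k)) ⟩
  diffsLeft 0 (Class 0 k) + ((diffsMiddle 0 (Class 0 k) + extra k K) + diffsRight 0 (Class 0 k))
    ≡⟨ move-extra (diffsLeft 0 (Class 0 k)) (diffsMiddle 0 (Class 0 k)) (extra k K) (diffsRight 0 (Class 0 k)) ⟩
  (diffsLeft 0 (Class 0 k) + (diffsMiddle 0 (Class 0 k) + diffsRight 0 (Class 0 k))) + extra k K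
    ≡⟨ cong (_+ extra k K) (sym (diffset-windows 0 (Class 0 k))) ⟩
  diffsetSize 72 (Class 0 k) + extra k K ∎
  where open ≡-Reasoning

baseClass : Fin 3 → List ℕ
baseClass zero             = L₀
baseClass (suc zero)       = 56 ∷ 57 ∷ 58 ∷ 60 ∷ 63 ∷ 64 ∷ 65 ∷ 69 ∷ 71 ∷ 72 ∷ []
baseClass (suc (suc zero)) =
  2 ∷ 5 ∷ 6 ∷ 7 ∷ 11 ∷ 13 ∷ 14 ∷ 18 ∷ 19 ∷ 20 ∷ 21 ∷ 22 ∷ 23 ∷ 24 ∷ 25 ∷ 26 ∷ 27 ∷ 28 ∷ 29 ∷ 30 ∷ 31 ∷ 32 ∷
  33 ∷ 34 ∷ 35 ∷ 36 ∷ 37 ∷ 38 ∷ 39 ∷ 40 ∷ 41 ∷ 42 ∷ 43 ∷ 44 ∷ 45 ∷ 46 ∷ 47 ∷ 48 ∷ 49 ∷ 50 ∷ 51 ∷ 52 ∷ 53 ∷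
  54 ∷ 55 ∷ 59 ∷ 61 ∷ 62 ∷ 66 ∷ 67 ∷ 68 ∷ 70 ∷ []

opaque
  unfolding Class

  Class-base : ∀ k → Class 0 k ≡ baseClass k
  Class-base zero             = refl
  Class-base (suc zero)       = refl
  Class-base (suc (suc zero)) = refl

-- Base case, checked by evaluation: the three base classes have
-- (|A + A|, |A − A|) = (32, 31), (32, 31) and (134, 133).
baseClass-MSTD : ∀ k → MSTD 72 (baseClass k)
baseClass-MSTD zero             = numeral-≤
baseClass-MSTD (suc zero)       = numeral-≤
baseClass-MSTD (suc (suc zero)) = numeral-≤

base-MSTD : ∀ k → MSTD 72 (Class 0 k)
base-MSTD k = subst (MSTD 72) (sym (Class-base k)) (baseClass-MSTD k)

-- Every class of the stretched partition is MSTD, since both sizes grow by the same amount.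
stretched-MSTD : ∀ K k → MSTD (72 + K) (Class K k)
stretched-MSTD K k =
  subst₂ _<_ (sym (diffset-growth K k)) (sym (sumset-growth K k)) (+-monoˡ-< (extra k K) (base-MSTD k))

-- Every class is nonempty: it contains 1, 72 + K and 18 respectively.
stretched-nonempty : ∀ K k → length (Class K k) > 0
stretched-nonempty K zero = ∈-length (from ∈-Class
  (≤-refl , ≤-trans (numeral-≤ {1} {72}) (m≤m+n 72 K) , stretched-low K (numeral-≤ {1} {36})))
stretched-nonempty K (suc zero) = ∈-length (from ∈-Class
  (s≤s z≤n , ≤-refl , stretched-high K (numeral-≤ {37} {72})))
stretched-nonempty K (suc (suc zero)) =
  ∈-length (Class-two-interval K ≤-refl (≤-trans (numeral-≤ {18} {55}) (m≤m+n 55 K)))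

stretched-partition : ∀ K → ThreeMSTDPartition (72 + K) (stretched K)
stretched-partition K k =
  subst (λ A → length A > 0 × MSTD (72 + K) A) (Class-def K k) (stretched-nonempty K k , stretched-MSTD K k)

lemma3p3 : ∃[ N ] ((r : ℕ) → r ≥ N → ∃[ c ] ThreeMSTDPartition r c)
lemma3p3 = 72 , λ r 72≤r → from-offset (m≤n⇒∃[o]m+o≡n 72≤r)
  where
  from-offset : ∀ {r} → (∃ λ K → 72 + K ≡ r) → ∃[ c ] ThreeMSTDPartition r c
  from-offset (K , refl) = stretched K , stretched-partition K
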